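{- Let $k,\ell$ be positive integers and let $\mathcal{F}\subseteq SOS_k(A_\ell)$ be a sunflower. Then $|\mathcal{F}|\le \left\lfloor \frac{\ell+1}{k}\right\rfloor - 1$.
   Context: Let $\varepsilon_1,\ldots,\varepsilon_{\ell+1}$ be the standard basis of $\mathbb{R}^{\ell+1}$. The root system $A_\ell$ is the set of vectors $\varepsilon_i-\varepsilon_j$, $i\neq j$. Two roots are strongly orthogonal if neither their sum nor their difference is a root (equivalently, in $A_\ell$, their supports are disjoint). $SOS_k(A_\ell)$ is the set of $k$-element subsets $\Gamma$ of $A_\ell$ whose elements are pairwise strongly orthogonal. For $\Gamma\in SOS_k(A_\ell)$ write $|\Gamma|=\sum_{\gamma\in\Gamma}\gamma\in\mathbb{R}^{\ell+1}$. A subset $\mathcal{F}\subseteq SOS_k(A_\ell)$ is an SOS-clique if for all distinct $\Gamma_i,\Gamma_j\in\mathcal{F}$ there exists $\Gamma_{i,j}\in SOS_k(A_\ell)$ with $|\Gamma_i|-|\Gamma_j|=|\Gamma_{i,j}|$. For $\Gamma,\Gamma'$ write $S(\Gamma,\Gamma')$ for the set of coordinates in which both $|\Gamma|$ and $|\Gamma'|$ are nonzero. An SOS-clique $\mathcal{F}$ is a sunflower if the sets $S(\Gamma_i,\Gamma_j)$ are the same for all pairs of distinct $\Gamma_i,\Gamma_j\in\mathcal{F}$. -}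

module Defs where

open import Data.Nat using (ℕ; suc; _≤_; _<_; _∸_; _/_; NonZero; >-nonZero)

open import Data.Integer using (ℤ; _-_; _+_; 0ℤ; 1ℤ)
open import Data.Fin using (Fin; _≟_)
open import Data.Product using (_×_; _,_; Σ; proj₁; proj₂)
open import Data.List using (List; []; _∷_; length)
open import Data.List.Relation.Unary.All using (All)
open import Data.List.Relation.Unary.AllPairs using (AllPairs)
open import Data.List.Relation.Unary.Unique.Propositional using (Unique)
open import Data.List.Membership.Propositional using (_∈_)
open import Relation.Binary.PropositionalEquality using (_≡_; _≢_)
open import Relation.Nullary using (¬_; does)
open import Data.Bool using (if_then_else_)
open import Function.Bundles using (_⇔_)

-- Coordinates of ℝ^{ℓ+1} are indexed by Fin (suc ℓ).
-- A root ε_i - ε_j of A_ℓ is encoded by the pair (i , j) with i ≢ j.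
Pair : ℕ → Set
Pair n = Fin n × Fin n

IsRoot : ∀ {n} → Pair n → Set
IsRoot (i , j) = i ≢ j

δ : ∀ {n} → Fin n → Fin n → ℤ
δ x i = if does (x ≟ i) then 1ℤ else 0ℤ

rootVec : ∀ {n} → Pair n → Fin n → ℤ
rootVec (i , j) x = δ x i - δ x j

∣_∣ᵥ : ∀ {n} → List (Pair n) → Fin n → ℤ
∣ [] ∣ᵥ x = 0ℤ
∣ γ ∷ Γ ∣ᵥ x = rootVec γ x + ∣ Γ ∣ᵥ x

-- Strong orthogonality in A_ℓ: disjoint supports {i,j} ∩ {i',j'} = ∅.
StronglyOrth : ∀ {n} → Pair n → Pair n → Set
StronglyOrth (i , j) (i' , j') = i ≢ i' × i ≢ j' × j ≢ i' × j ≢ j'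

-- Γ ∈ SOS_k(A_ℓ) (with n = ℓ + 1): a k-element set of roots (given as a
-- duplicate-free list) whose elements are pairwise strongly orthogonal.
IsSOS : ∀ {n} → ℕ → List (Pair n) → Set
IsSOS k Γ = All IsRoot Γ × Unique Γ × length Γ ≡ k × AllPairs StronglyOrth Γ

SameSet : ∀ {n} → List (Pair n) → List (Pair n) → Set
SameSet Γ Γ' = ∀ r → (r ∈ Γ) ⇔ (r ∈ Γ')

IsSOSFamily : ∀ {n} → ℕ → (m : ℕ) → (Fin m → List (Pair n)) → Set
IsSOSFamily k m F =
  (∀ a → IsSOS k (F a)) × (∀ a b → a ≢ b → ¬ SameSet (F a) (F b))

IsSOSClique : ∀ {n} → ℕ → (m : ℕ) → (Fin m → List (Pair n)) → Set
IsSOSClique {n} k m F =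
  IsSOSFamily k m F ×
  (∀ a b → a ≢ b → Σ (List (Pair n)) λ Δ →
      IsSOS k Δ × (∀ x → ∣ F a ∣ᵥ x - ∣ F b ∣ᵥ x ≡ ∣ Δ ∣ᵥ x))

InS : ∀ {n} → List (Pair n) → List (Pair n) → Fin n → Set
InS Γ Γ' x = ∣ Γ ∣ᵥ x ≢ 0ℤ × ∣ Γ' ∣ᵥ x ≢ 0ℤ

IsSunflower : ∀ {n} → ℕ → (m : ℕ) → (Fin m → List (Pair n)) → Set
IsSunflower k m F =
  IsSOSClique k m F ×
  (∀ a b c d → a ≢ b → c ≢ d → ∀ x → InS (F a) (F b) x ⇔ InS (F c) (F d) x)

bound : (k ℓ : ℕ) → 0 < k → ℕ
bound k ℓ hk = _/_ (suc ℓ) k {{>-nonZero hk}} ∸ 1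

module Submission where

-- Every Γ ∈ SOS_k(A_ℓ) has entries in {-1, 0, 1} and exactly 2k nonzero
-- coordinates.  If |Γ| - |Γ'| = |Δ| with Δ ∈ SOS_k, the support of Δ is the
-- symmetric difference of those of Γ and Γ', and 2k = |supp Δ| forces the
-- supports of Γ and Γ' to share exactly k coordinates.  In a sunflower they
-- all share the same k-element core S, so the petals supp Γ \ S are pairwise
-- disjoint k-sets outside S; hence k + m k ≤ ℓ + 1.

open import Defs
open import Data.Nat using (ℕ; zero; suc; _≤_; _<_; _+_; _*_; _∸_; _/_; ⌊_/2⌋; z≤n; s≤s; >-nonZero)
open import Data.Nat.Properties using (+-suc; +-cancelˡ-≡; +-cancelʳ-≡; +-assoc; +-identityʳ; m≤n⇒m≤1+n; ∸-monoˡ-≤; n≡⌊n+n/2⌋)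
open import Data.Nat.DivMod using (/-monoˡ-≤; m*n/n≡m)
open import Data.Integer as ℤ using (ℤ; -[1+_]; 0ℤ; 1ℤ; -1ℤ; _-_)
open import Data.Integer.Properties using () renaming (+-identityˡ to ℤ+-identityˡ; +-identityʳ to ℤ+-identityʳ)
open import Data.Bool using (Bool; true; false; _∧_; _∨_; not; _xor_; if_then_else_)
open import Data.Bool.Properties using (∧-zeroʳ; ∧-comm; ∧-distribʳ-∨; ∨-identityʳ)
open import Data.Fin using (Fin; zero; suc; _≟_)
open import Data.Fin.Properties using () renaming (suc-injective to Fin-suc-injective)
open import Data.List using (List; []; _∷_; length)
open import Data.List.Relation.Unary.All as All using (All; []; _∷_)
open import Data.List.Relation.Unary.AllPairs using (AllPairs; []; _∷_)
open import Data.Product using (_×_; _,_; proj₁; proj₂)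
open import Data.Sum using (_⊎_; inj₁; inj₂)
open import Data.Empty using (⊥-elim)
open import Function using (_∘_; id)
open import Function.Bundles using (_⇔_; Equivalence; mk⇔)
open import Relation.Binary.PropositionalEquality
open import Relation.Nullary using (yes; no; does)
open import Relation.Nullary.Decidable using (dec-false)

count : ∀ {n} → (Fin n → Bool) → ℕ
count {zero}  f = 0
count {suc n} f = (if f zero then suc else id) (count (f ∘ suc))

Disjoint : ∀ {n} → (Fin n → Bool) → (Fin n → Bool) → Set
Disjoint f g = ∀ x → f x ∧ g x ≡ false

count-cong : ∀ {n} {f g : Fin n → Bool} → (∀ x → f x ≡ g x) → count f ≡ count g
count-cong {zero}  _   = refl
count-cong {suc n} {f} {g} f≗g rewrite f≗g zero =
  cong (if g zero then suc else id) (count-cong (f≗g ∘ suc))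

count-≤ : ∀ {n} (f : Fin n → Bool) → count f ≤ n
count-≤ {zero}  f = z≤n
count-≤ {suc n} f with f zero
... | true  = s≤s (count-≤ (f ∘ suc))
... | false = m≤n⇒m≤1+n (count-≤ (f ∘ suc))

count-false : ∀ n → count {n} (λ _ → false) ≡ 0
count-false zero    = refl
count-false (suc n) = count-false n

count-≟ : ∀ {n} (i : Fin n) → count (λ x → does (x ≟ i)) ≡ 1
count-≟ {suc n} zero    = cong suc (count-false n)
count-≟ {suc n} (suc i) = count-≟ i

count-∨ : ∀ {n} (f g : Fin n → Bool) → Disjoint f g →
          count (λ x → f x ∨ g x) ≡ count f + count g
count-∨ {zero}  f g _ = refl
count-∨ {suc n} f g f∩g=∅
  with f zero | g zero | f∩g=∅ zero | count-∨ (f ∘ suc) (g ∘ suc) (f∩g=∅ ∘ suc)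
... | true  | true  | () | _
... | true  | false | _  | ih = cong suc ih
... | false | true  | _  | ih = trans (cong suc ih) (sym (+-suc _ _))
... | false | false | _  | ih = ih

count-split : ∀ {n} (f g : Fin n → Bool) →
              count f ≡ count (λ x → f x ∧ g x) + count (λ x → f x ∧ not (g x))
count-split f g = trans (count-cong (λ x → split (f x) (g x)))
                        (count-∨ _ _ (λ x → disjoint (f x) (g x)))
  where
  split : ∀ a b → a ≡ (a ∧ b) ∨ (a ∧ not b)
  split true  true  = refl
  split true  false = refl
  split false _     = refl
  disjoint : ∀ a b → (a ∧ b) ∧ (a ∧ not b) ≡ false
  disjoint true  true  = refl
  disjoint true  false = refl
  disjoint false _     = refl

disjoint-family-≤ : ∀ {n m} (c k : ℕ) (Q : Fin n → Bool) (P : Fin m → Fin n → Bool) →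
  count Q ≡ c → (∀ a → count (P a) ≡ k) →
  (∀ a → Disjoint Q (P a)) → (∀ a b → a ≢ b → Disjoint (P a) (P b)) →
  c + m * k ≤ n
disjoint-family-≤ {n} {zero} c k Q P ∣Q∣ ∣P∣ Q∩P=∅ P∩P=∅ =
  subst (_≤ n) (trans ∣Q∣ (sym (+-identityʳ c))) (count-≤ Q)
disjoint-family-≤ {n} {suc m} c k Q P ∣Q∣ ∣P∣ Q∩P=∅ P∩P=∅ =
  subst (_≤ n) (+-assoc c k (m * k))
    (disjoint-family-≤ (c + k) k (λ x → Q x ∨ P zero x) (P ∘ suc)
      (trans (count-∨ Q (P zero) (Q∩P=∅ zero)) (cong₂ _+_ ∣Q∣ (∣P∣ zero)))
      (∣P∣ ∘ suc)
      (λ a x → trans (∧-distribʳ-∨ (P (suc a) x) (Q x) (P zero x))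
                     (cong₂ _∨_ (Q∩P=∅ (suc a) x) (P∩P=∅ zero (suc a) (λ ()) x)))
      (λ a b a≢b → P∩P=∅ (suc a) (suc b) (a≢b ∘ Fin-suc-injective)))

isNonZero : ℤ → Bool
isNonZero (ℤ.+ zero)  = false
isNonZero (ℤ.+ suc _) = true
isNonZero -[1+ _ ]    = true

isNonZero⇒≢0 : ∀ z → isNonZero z ≡ true → z ≢ 0ℤ
isNonZero⇒≢0 (ℤ.+ suc _) _ ()
isNonZero⇒≢0 -[1+ _ ]    _ ()

≢0⇒isNonZero : ∀ z → z ≢ 0ℤ → isNonZero z ≡ true
≢0⇒isNonZero (ℤ.+ zero)  z≢0 = ⊥-elim (z≢0 refl)
≢0⇒isNonZero (ℤ.+ suc _) _   = refl
≢0⇒isNonZero -[1+ _ ]    _   = refl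

data Trit : ℤ → Set where
  0ᵗ  : Trit 0ℤ
  1ᵗ  : Trit 1ℤ
  -1ᵗ : Trit -1ℤ

module _ {a b : ℤ} where

  trit-+ : a ≡ 0ℤ ⊎ b ≡ 0ℤ → Trit a → Trit b → Trit (a ℤ.+ b)
  trit-+ (inj₁ refl) _  tb = subst Trit (sym (ℤ+-identityˡ b)) tb
  trit-+ (inj₂ refl) ta _  = subst Trit (sym (ℤ+-identityʳ a)) ta

  isNonZero-+ : a ≡ 0ℤ ⊎ b ≡ 0ℤ → isNonZero (a ℤ.+ b) ≡ isNonZero a ∨ isNonZero b
  isNonZero-+ (inj₁ refl) = cong isNonZero (ℤ+-identityˡ b)
  isNonZero-+ (inj₂ refl) = trans (cong isNonZero (ℤ+-identityʳ a)) (sym (∨-identityʳ _))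

  isNonZero-∧ : a ≡ 0ℤ ⊎ b ≡ 0ℤ → isNonZero a ∧ isNonZero b ≡ false
  isNonZero-∧ (inj₁ refl) = refl
  isNonZero-∧ (inj₂ refl) = ∧-zeroʳ _

isNonZero-difference : ∀ {a b} → Trit a → Trit b → Trit (a - b) →
  isNonZero (a - b) ≡ isNonZero a xor isNonZero b
isNonZero-difference 0ᵗ  0ᵗ  _  = refl
isNonZero-difference 0ᵗ  1ᵗ  _  = refl
isNonZero-difference 0ᵗ  -1ᵗ _  = refl
isNonZero-difference 1ᵗ  0ᵗ  _  = refl
isNonZero-difference 1ᵗ  1ᵗ  _  = refl
isNonZero-difference 1ᵗ  -1ᵗ ()
isNonZero-difference -1ᵗ 0ᵗ  _  = refl
isNonZero-difference -1ᵗ 1ᵗ  ()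
isNonZero-difference -1ᵗ -1ᵗ _  = refl

+-pairwise≡k+k⇒≡k : ∀ {i p q k} → i + p ≡ k + k → i + q ≡ k + k → p + q ≡ k + k → i ≡ k
+-pairwise≡k+k⇒≡k {i} {p} {q} {k} i+p≡2k i+q≡2k p+q≡2k =
  +-cancelʳ-≡ k i k (trans (cong (i +_) (sym p≡k)) i+p≡2k)
  where
  p≡q : p ≡ q
  p≡q = +-cancelˡ-≡ i p q (trans i+p≡2k (sym i+q≡2k))
  p≡k : p ≡ k
  p≡k = begin
    p                ≡⟨ n≡⌊n+n/2⌋ p ⟩
    ⌊ p + p /2⌋      ≡⟨ cong (λ r → ⌊ p + r /2⌋) p≡q ⟩
    ⌊ p + q /2⌋      ≡⟨ cong ⌊_/2⌋ p+q≡2k ⟩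
    ⌊ k + k /2⌋      ≡⟨ sym (n≡⌊n+n/2⌋ k) ⟩
    k                ∎
    where open ≡-Reasoning

module _ {n : ℕ} where

  δ-≢ : {x i : Fin n} → x ≢ i → δ x i ≡ 0ℤ
  δ-≢ {x} {i} x≢i = cong (if_then 1ℤ else 0ℤ) (dec-false (x ≟ i) x≢i)

  trit-rootVec : ∀ (i j x : Fin n) → Trit (rootVec (i , j) x)
  trit-rootVec i j x with x ≟ i | x ≟ j
  ... | yes _ | yes _ = 0ᵗ
  ... | yes _ | no _  = 1ᵗ
  ... | no _  | yes _ = -1ᵗ
  ... | no _  | no _  = 0ᵗ

  isNonZero-rootVec : ∀ {i j : Fin n} → i ≢ j → ∀ x →
    isNonZero (rootVec (i , j) x) ≡ does (x ≟ i) ∨ does (x ≟ j)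
  isNonZero-rootVec {i} {j} i≢j x with x ≟ i | x ≟ j
  ... | yes x≡i | yes x≡j = ⊥-elim (i≢j (trans (sym x≡i) x≡j))
  ... | yes _   | no _    = refl
  ... | no _    | yes _   = refl
  ... | no _    | no _    = refl

  count-rootVec : ∀ {i j : Fin n} → i ≢ j → count (isNonZero ∘ rootVec (i , j)) ≡ 2
  count-rootVec {i} {j} i≢j = begin
    count (isNonZero ∘ rootVec (i , j))
      ≡⟨ count-cong (isNonZero-rootVec i≢j) ⟩
    count (λ x → does (x ≟ i) ∨ does (x ≟ j))
      ≡⟨ count-∨ _ _ i∩j=∅ ⟩
    count (λ x → does (x ≟ i)) + count (λ x → does (x ≟ j))
      ≡⟨ cong₂ _+_ (count-≟ i) (count-≟ j) ⟩
    2 ∎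
    where
    open ≡-Reasoning
    i∩j=∅ : Disjoint (λ x → does (x ≟ i)) (λ x → does (x ≟ j))
    i∩j=∅ x with x ≟ i | x ≟ j
    ... | yes x≡i | yes x≡j = ⊥-elim (i≢j (trans (sym x≡i) x≡j))
    ... | yes _   | no _    = refl
    ... | no _    | _       = refl

  ∣∣ᵥ-untouched : ∀ (x : Fin n) (Γ : List (Pair n)) →
    All (λ r → proj₁ r ≢ x × proj₂ r ≢ x) Γ → ∣ Γ ∣ᵥ x ≡ 0ℤ
  ∣∣ᵥ-untouched x []            []                 = refl
  ∣∣ᵥ-untouched x ((i , j) ∷ Γ) ((i≢x , j≢x) ∷ Γ≢x)
    rewrite δ-≢ (i≢x ∘ sym) | δ-≢ (j≢x ∘ sym) | ∣∣ᵥ-untouched x Γ Γ≢x = refl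

  rootVec≡0⊎∣∣ᵥ≡0 : ∀ (i j : Fin n) (Γ : List (Pair n)) → All (StronglyOrth (i , j)) Γ →
    ∀ x → rootVec (i , j) x ≡ 0ℤ ⊎ ∣ Γ ∣ᵥ x ≡ 0ℤ
  rootVec≡0⊎∣∣ᵥ≡0 i j Γ orth x with x ≟ i | x ≟ j
  ... | yes refl | _        = inj₂ (∣∣ᵥ-untouched x Γ (All.map (λ (a , b , _ , _) → a ∘ sym , b ∘ sym) orth))
  ... | no _     | yes refl = inj₂ (∣∣ᵥ-untouched x Γ (All.map (λ (_ , _ , c , d) → c ∘ sym , d ∘ sym) orth))
  ... | no _     | no _     = inj₁ refl

  trit-∣∣ᵥ : ∀ (Γ : List (Pair n)) → AllPairs StronglyOrth Γ → ∀ x → Trit (∣ Γ ∣ᵥ x)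
  trit-∣∣ᵥ []            []           x = 0ᵗ
  trit-∣∣ᵥ ((i , j) ∷ Γ) (orth ∷ Γ-so) x =
    trit-+ (rootVec≡0⊎∣∣ᵥ≡0 i j Γ orth x) (trit-rootVec i j x) (trit-∣∣ᵥ Γ Γ-so x)

  support : List (Pair n) → Fin n → Bool
  support Γ = isNonZero ∘ ∣ Γ ∣ᵥ

  count-support : ∀ (Γ : List (Pair n)) → All IsRoot Γ → AllPairs StronglyOrth Γ →
    count (support Γ) ≡ length Γ + length Γ
  count-support []            []             []           = count-false n
  count-support ((i , j) ∷ Γ) (i≢j ∷ Γ-roots) (orth ∷ Γ-so) = begin
    count (support ((i , j) ∷ Γ))
      ≡⟨ count-cong (isNonZero-+ ∘ apart) ⟩
    count (λ x → isNonZero (rootVec (i , j) x) ∨ support Γ x)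
      ≡⟨ count-∨ _ _ (isNonZero-∧ ∘ apart) ⟩
    count (isNonZero ∘ rootVec (i , j)) + count (support Γ)
      ≡⟨ cong (_+ count (support Γ)) (count-rootVec i≢j) ⟩
    2 + count (support Γ)
      ≡⟨ cong (2 +_) (count-support Γ Γ-roots Γ-so) ⟩
    2 + (length Γ + length Γ)
      ≡⟨ cong suc (sym (+-suc (length Γ) (length Γ))) ⟩
    suc (length Γ) + suc (length Γ) ∎
    where
    open ≡-Reasoning
    apart : ∀ x → rootVec (i , j) x ≡ 0ℤ ⊎ ∣ Γ ∣ᵥ x ≡ 0ℤ
    apart = rootVec≡0⊎∣∣ᵥ≡0 i j Γ orth

  count-support-SOS : ∀ {k} (Γ : List (Pair n)) → IsSOS k Γ → count (support Γ) ≡ k + k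
  count-support-SOS Γ (roots , _ , refl , so) = count-support Γ roots so

  support-difference : ∀ (A B D : List (Pair n)) →
    AllPairs StronglyOrth A → AllPairs StronglyOrth B → AllPairs StronglyOrth D →
    (∀ x → ∣ A ∣ᵥ x - ∣ B ∣ᵥ x ≡ ∣ D ∣ᵥ x) →
    ∀ x → support D x ≡ support A x xor support B x
  support-difference A B D A-so B-so D-so A-B≡D x =
    trans (cong isNonZero (sym (A-B≡D x)))
          (isNonZero-difference (trit-∣∣ᵥ A A-so x) (trit-∣∣ᵥ B B-so x)
                       (subst Trit (sym (A-B≡D x)) (trit-∣∣ᵥ D D-so x)))

  count-common-support : ∀ {k} (A B D : List (Pair n)) → IsSOS k A → IsSOS k B → IsSOS k D →
    (∀ x → ∣ A ∣ᵥ x - ∣ B ∣ᵥ x ≡ ∣ D ∣ᵥ x) →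
    count (λ x → support A x ∧ support B x) ≡ k
  count-common-support {k} A B D A-sos@(_ , _ , _ , A-so) B-sos@(_ , _ , _ , B-so)
                       D-sos@(_ , _ , _ , D-so) A-B≡D =
    +-pairwise≡k+k⇒≡k ∣A∩B∣+∣A∖B∣ ∣A∩B∣+∣B∖A∣ ∣A∖B∣+∣B∖A∣
    where
    open ≡-Reasoning
    a b : Fin n → Bool
    a = support A
    b = support B

    ∣A∩B∣+∣A∖B∣ : count (λ x → a x ∧ b x) + count (λ x → a x ∧ not (b x)) ≡ k + k
    ∣A∩B∣+∣A∖B∣ = trans (sym (count-split a b)) (count-support-SOS A A-sos)

    ∣A∩B∣+∣B∖A∣ : count (λ x → a x ∧ b x) + count (λ x → b x ∧ not (a x)) ≡ k + k
    ∣A∩B∣+∣B∖A∣ = begin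
      count (λ x → a x ∧ b x) + count (λ x → b x ∧ not (a x))
        ≡⟨ cong (_+ count (λ x → b x ∧ not (a x))) (count-cong (λ x → ∧-comm (a x) (b x))) ⟩
      count (λ x → b x ∧ a x) + count (λ x → b x ∧ not (a x))
        ≡⟨ sym (count-split b a) ⟩
      count b
        ≡⟨ count-support-SOS B B-sos ⟩
      k + k ∎

    ∣A∖B∣+∣B∖A∣ : count (λ x → a x ∧ not (b x)) + count (λ x → b x ∧ not (a x)) ≡ k + k
    ∣A∖B∣+∣B∖A∣ = begin
      count (λ x → a x ∧ not (b x)) + count (λ x → b x ∧ not (a x))
        ≡⟨ sym (cong₂ _+_ (count-cong (D∧A≡A∖B ∘ D≡A⊕B)) (count-cong (D∖A≡B∖A ∘ D≡A⊕B))) ⟩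
      count (λ x → support D x ∧ a x) + count (λ x → support D x ∧ not (a x))
        ≡⟨ sym (count-split (support D) a) ⟩
      count (support D)
        ≡⟨ count-support-SOS D D-sos ⟩
      k + k ∎
      where
      D≡A⊕B : ∀ x → support D x ≡ a x xor b x
      D≡A⊕B = support-difference A B D A-so B-so D-so A-B≡D
      D∧A≡A∖B : ∀ {w u v} → w ≡ u xor v → w ∧ u ≡ u ∧ not v
      D∧A≡A∖B {u = true}  {true}  refl = refl
      D∧A≡A∖B {u = true}  {false} refl = refl
      D∧A≡A∖B {u = false} {v}     refl = ∧-zeroʳ v
      D∖A≡B∖A : ∀ {w u v} → w ≡ u xor v → w ∧ not u ≡ v ∧ not u
      D∖A≡B∖A {u = true}  {v}     refl = trans (∧-zeroʳ (not v)) (sym (∧-zeroʳ v))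
      D∖A≡B∖A {u = false} {true}  refl = refl
      D∖A≡B∖A {u = false} {false} refl = refl

  InS⇔supports : ∀ (Γ Γ′ : List (Pair n)) x → InS Γ Γ′ x ⇔ (support Γ x ∧ support Γ′ x ≡ true)
  InS⇔supports Γ Γ′ x = mk⇔ to from
    where
    to : InS Γ Γ′ x → support Γ x ∧ support Γ′ x ≡ true
    to (Γ-x≢0 , Γ′-x≢0) rewrite ≢0⇒isNonZero _ Γ-x≢0 | ≢0⇒isNonZero _ Γ′-x≢0 = refl
    from : support Γ x ∧ support Γ′ x ≡ true → InS Γ Γ′ x
    from Γ∧Γ′ with support Γ x in Γ-x | support Γ′ x in Γ′-x
    from () | false | _
    from () | true  | false
    from _  | true  | true = isNonZero⇒≢0 _ Γ-x , isNonZero⇒≢0 _ Γ′-x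

module Sunflower {n k m : ℕ} (F : Fin (suc (suc m)) → List (Pair n))
                 (sunflower : IsSunflower k (suc (suc m)) F) where

  private
    sos : ∀ a → IsSOS k (F a)
    sos = proj₁ (proj₁ (proj₁ sunflower))

    same-S : ∀ a b c d → a ≢ b → c ≢ d → ∀ x → InS (F a) (F b) x ⇔ InS (F c) (F d) x
    same-S = proj₂ sunflower

    0₁ 1₁ : Fin (suc (suc m))
    0₁ = zero
    1₁ = suc zero

    partner : Fin (suc (suc m)) → Fin (suc (suc m))
    partner zero    = 1₁
    partner (suc _) = 0₁

    ≢partner : ∀ a → a ≢ partner a
    ≢partner zero    ()
    ≢partner (suc _) ()

  core : Fin n → Bool
  core x = support (F 0₁) x ∧ support (F 1₁) x

  petal : Fin (suc (suc m)) → Fin n → Bool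
  petal a x = support (F a) x ∧ not (core x)

  count-core : count core ≡ k
  count-core with proj₂ (proj₁ sunflower) 0₁ 1₁ (λ ())
  ... | D , D-sos , F₀-F₁≡D = count-common-support (F 0₁) (F 1₁) D (sos 0₁) (sos 1₁) D-sos F₀-F₁≡D

  core⊆support : ∀ a x → core x ≡ true → support (F a) x ≡ true
  core⊆support a x core-x =
    ≢0⇒isNonZero _ (proj₁ (Equivalence.from (same-S a (partner a) 0₁ 1₁ (≢partner a) (λ ()) x)
                                             (Equivalence.from (InS⇔supports (F 0₁) (F 1₁) x) core-x)))

  petals-disjoint : ∀ a b → a ≢ b → Disjoint (petal a) (petal b)
  petals-disjoint a b a≢b x with support (F a) x in Fa-x | support (F b) x in Fb-x
  ... | false | _     = refl
  ... | true  | false = ∧-zeroʳ (not (core x))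
  ... | true  | true  = cong (λ c → not c ∧ not c) core-x
    where
    core-x : core x ≡ true
    core-x = Equivalence.to (InS⇔supports (F 0₁) (F 1₁) x)
               (Equivalence.to (same-S a b 0₁ 1₁ a≢b (λ ()) x)
                 (Equivalence.from (InS⇔supports (F a) (F b) x) (cong₂ _∧_ Fa-x Fb-x)))

  core∩petal=∅ : ∀ a → Disjoint core (petal a)
  core∩petal=∅ a x with core x
  ... | true  = ∧-zeroʳ (support (F a) x)
  ... | false = refl

  count-petal : ∀ a → count (petal a) ≡ k
  count-petal a = +-cancelˡ-≡ k (count (petal a)) k (begin
    k + count (petal a)
      ≡⟨ cong (_+ count (petal a)) count-core ⟨
    count core + count (petal a)
      ≡⟨ cong (_+ count (petal a)) (count-cong support∧core≡core) ⟨
    count (λ x → support (F a) x ∧ core x) + count (petal a)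
      ≡⟨ count-split (support (F a)) core ⟨
    count (support (F a))
      ≡⟨ count-support-SOS (F a) (sos a) ⟩
    k + k ∎)
    where
    open ≡-Reasoning
    support∧core≡core : ∀ x → support (F a) x ∧ core x ≡ core x
    support∧core≡core x with core x in core-x
    ... | true  = cong (_∧ true) (core⊆support a x core-x)
    ... | false = ∧-zeroʳ (support (F a) x)

  size-bound : suc (suc (suc m)) * k ≤ n
  size-bound = disjoint-family-≤ k k core petal count-core count-petal core∩petal=∅ petals-disjoint

suc[m]*k≤n⇒m≤n/k∸1 : ∀ {m k n} (k>0 : 0 < k) → suc m * k ≤ n → m ≤ _/_ n k {{>-nonZero k>0}} ∸ 1
suc[m]*k≤n⇒m≤n/k∸1 {m} {suc k} {n} _ [1+m]k≤n =
  ∸-monoˡ-≤ 1 (subst (_≤ n / suc k) (m*n/n≡m (suc m) (suc k)) (/-monoˡ-≤ (suc k) [1+m]k≤n))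

lemma3p2 : (k ℓ : ℕ) (hk : 0 < k) → 0 < ℓ →
    (m : ℕ) (F : Fin m → List (Pair (suc ℓ))) →
    IsSunflower k m F → m ≤ bound k ℓ hk
lemma3p2 k ℓ hk _ zero          _ _ = z≤n
lemma3p2 k ℓ hk _ (suc zero)    F (((sos , _) , _) , _) =
  suc[m]*k≤n⇒m≤n/k∸1 hk (subst (_≤ suc ℓ) ∣support∣≡2k (count-≤ (support (F zero))))
  where
  ∣support∣≡2k : count (support (F zero)) ≡ 2 * k
  ∣support∣≡2k = trans (count-support-SOS (F zero) (sos zero)) (cong (k +_) (sym (+-identityʳ k)))
lemma3p2 k ℓ hk _ (suc (suc m)) F sunflower =
  suc[m]*k≤n⇒m≤n/k∸1 hk (Sunflower.size-bound F sunflower)
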